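{- Let $\mathrm{DASH}$ be run on any connected graph $G$ on $n$ nodes under any sequence of adversarial single-node deletions, with weights maintained as in the context. Then at any time, for any node $v$ and every node $q\in N(v,G')$, $W(T(v,q))\ge \mathrm{rem}(v)$.
   Context: Model: the network is initially a connected graph $G$ on $n$ nodes. In each round an adversary deletes one node $x$; then the healing algorithm may add edges only between former neighbors of $x$. $G$ denotes the current network, and $G'$ denotes the graph on the current nodes whose edges are exactly the healing edges added so far. $N(v,G)$, $N(v,G')$ are neighbor sets; $\delta(v)$ is the current degree of $v$ minus its initial degree. Algorithm $\mathrm{DASH}$: Initially every vertex is given an $ID$ chosen uniformly at random from $[0,1]$. When a vertex $v$ is deleted: partition the neighbors of $v$ in $G$ not having the same $ID$ as $v$ into classes according to their $ID$, and let $UN(v,G)$ contain one representative of each class (the one with lowest initial $ID$). Let $S=UN(v,G)\cup N(v,G')$. Connect the nodes of $S$ by new edges into a complete binary tree, filling positions top-down, left to right, in increasing order of $\delta$. Let $MINID$ be the minimum $ID$ in $S$; propagate it through the tree of $G'$ containing $S$, and all nodes of that tree set their $ID$ to $MINID$. (The graph $G'$ is always a forest.) Weights (for analysis): each vertex $v$ has a weight $w(v)$, initially $1$; when $v$ is deleted, $w(v)$ is added to the weight of an arbitrarily chosen neighbor of $v$ in $G'$. For a subgraph $S$, $W(S)$ is the sum of weights of its vertices. $T(x,y)$ denotes the tree (connected component) of $G'-y$ containing $x$. For a vertex $v$, $\mathrm{rem}(v)=\sum_{u\in N(v,G')}W(T(u,v))-\max_{u\in N(v,G')}W(T(u,v))+w(v)$.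 -}

module Defs where

open import Data.Nat using (ℕ; zero; suc; _+_; _∸_; _≤_; _⊔_; _/_)
open import Data.Bool using (Bool; true; false; _∧_; _∨_; not; if_then_else_)
open import Data.Fin using (Fin; toℕ; _≟_)
open import Data.List using (List; []; length; lookup; allFin; map; foldr)
open import Data.Nat.ListAction using (sum)
open import Data.Bool.ListAction using (any)
open import Data.List.Membership.Propositional using (_∈_)
open import Data.List.Relation.Unary.Unique.Propositional using (Unique)
open import Data.Integer as ℤ using (ℤ; +_; _-_)
open import Data.Product using (Σ; _×_; _,_)
open import Data.Sum using (_⊎_)
open import Function.Bundles using (_⇔_)
open import Relation.Nullary using (¬_)
open import Relation.Nullary.Decidable using (⌊_⌋)
open import Relation.Binary.PropositionalEquality using (_≡_; _≢_)

Graph : ℕ → Set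
Graph n = Fin n → Fin n → Bool

_==_ : ∀ {n} → Fin n → Fin n → Bool
a == b = ⌊ a ≟ b ⌋

Σᵥ : ∀ {n} → (Fin n → ℕ) → ℕ
Σᵥ {n} f = sum (map f (allFin n))

maxᵥ : ∀ {n} → (Fin n → ℕ) → ℕ
maxᵥ {n} f = foldr _⊔_ 0 (map f (allFin n))

anyᵥ : ∀ {n} → (Fin n → Bool) → Bool
anyᵥ {n} f = any f (allFin n)

reachWithin : ∀ {n} → Graph n → ℕ → Fin n → Fin n → Bool
reachWithin g zero    a b = a == b
reachWithin g (suc k) a b =
  reachWithin g k a b ∨ anyᵥ (λ c → reachWithin g k a c ∧ g c b)

-- reachability (same connected component); walks of length ≤ n suffice
reach : ∀ {n} → Graph n → Fin n → Fin n → Bool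
reach {n} g a b = reachWithin g n a b

deleteV : ∀ {n} → Graph n → Fin n → Graph n
deleteV g y a b = g a b ∧ not (a == y) ∧ not (b == y)

Symmetric : ∀ {n} → Graph n → Set
Symmetric g = ∀ a b → g a b ≡ g b a

Irreflexive : ∀ {n} → Graph n → Set
Irreflexive g = ∀ a → g a a ≡ false

Connected : ∀ {n} → Graph n → Set
Connected g = ∀ a b → reach g a b ≡ true

InjectiveIDs : ∀ {n} → (Fin n → ℕ) → Set
InjectiveIDs f = ∀ a b → f a ≡ f b → a ≡ b

degree : ∀ {n} → Graph n → Fin n → ℕ
degree g v = Σᵥ (λ u → if g v u then 1 else 0)

record State (n : ℕ) : Set where
  field
    alive : Fin n → Bool
    E     : Graph n             -- current network G
    H     : Graph n             -- healing graph G'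
    ID    : Fin n → ℕ
    w     : Fin n → ℕ           -- weights (analysis only)
open State public

initState : ∀ {n} → Graph n → (Fin n → ℕ) → State n
initState G0 ID0 = record
  { alive = λ _ → true ; E = G0 ; H = λ _ _ → false ; ID = ID0 ; w = λ _ → 1 }

δ : ∀ {n} → Graph n → State n → Fin n → ℤ
δ G0 s v = (+ degree (E s) v) - (+ degree G0 v)

-- complete binary tree on the list σ (positions 0,1,2,… top-down,
-- left to right): position i ≥ 1 has parent (i-1)/2.
TreeEdge : ∀ {n} → List (Fin n) → Fin n → Fin n → Set
TreeEdge σ a b =
  Σ (Fin (length σ)) λ i → Σ (Fin (length σ)) λ j →
    (1 ≤ toℕ i) × (toℕ j ≡ (toℕ i ∸ 1) / 2) × (lookup σ i ≡ a) × (lookup σ j ≡ b)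

-- UN(x,G): representatives (lowest initial ID) of the ID classes of
-- neighbours of x in G whose ID differs from that of x.
InUN : ∀ {n} → (Fin n → ℕ) → State n → Fin n → Fin n → Set
InUN ID0 s x u =
  (E s x u ≡ true) × (ID s u ≢ ID s x) ×
  (∀ u' → E s x u' ≡ true → ID s u' ≡ ID s u → ID0 u ≤ ID0 u')

InS : ∀ {n} → (Fin n → ℕ) → State n → Fin n → Fin n → Set
InS ID0 s x u = InUN ID0 s x u ⊎ (H s x u ≡ true)

-- One round: adversary deletes x, DASH heals, weights are updated.
-- All "arbitrary" choices (tie-breaking in δ-order, the neighbour
-- receiving w(x)) are existentially part of the step.
record Step {n} (G0 : Graph n) (ID0 : Fin n → ℕ) (s s' : State n) : Set where
  field
    x       : Fin n
    x-alive : alive s x ≡ true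
    σ        : List (Fin n)
    σ-unique : Unique σ
    σ-mem    : ∀ u → (u ∈ σ) ⇔ InS ID0 s x u
    σ-sorted : ∀ i j → toℕ i ≤ toℕ j →
               δ G0 s (lookup σ i) ℤ.≤ δ G0 s (lookup σ j)
    alive' : ∀ u → alive s' u ≡ (alive s u ∧ not (u == x))
    E'     : ∀ a b → (E s' a b ≡ true) ⇔
               ((deleteV (E s) x a b ≡ true) ⊎ TreeEdge σ a b ⊎ TreeEdge σ b a)
    H'     : ∀ a b → (H s' a b ≡ true) ⇔
               ((deleteV (H s) x a b ≡ true) ⊎ TreeEdge σ a b ⊎ TreeEdge σ b a)
    minid      : ℕ
    minid-low  : ∀ u → InS ID0 s x u → minid ≤ ID s u
    minid-attained : ∀ u → InS ID0 s x u → Σ (Fin n) λ t → InS ID0 s x t × (ID s t ≡ minid)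
    ID-in  : ∀ u → (Σ (Fin n) λ t → InS ID0 s x t × (reach (H s') t u ≡ true)) →
             ID s' u ≡ minid
    ID-out : ∀ u → ¬ (Σ (Fin n) λ t → InS ID0 s x t × (reach (H s') t u ≡ true)) →
             ID s' u ≡ ID s u
    weights : (Σ (Fin n) λ y → (H s x y ≡ true) × (w s' y ≡ w s y + w s x) ×
                 (∀ z → z ≢ y → w s' z ≡ w s z))
              ⊎ ((∀ y → H s x y ≡ false) × (∀ z → w s' z ≡ w s z))

data Reachable {n} (G0 : Graph n) (ID0 : Fin n → ℕ) : State n → Set where
  init : Reachable G0 ID0 (initState G0 ID0)
  step : ∀ {s s'} → Reachable G0 ID0 s → Step G0 ID0 s s' → Reachable G0 ID0 s'

-- membership of z in T(x,y): the component of G' − y containing x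
inT : ∀ {n} → State n → Fin n → Fin n → Fin n → Bool
inT s x y z = not (x == y) ∧ reach (deleteV (H s) y) x z

WT : ∀ {n} → State n → Fin n → Fin n → ℕ
WT s x y = Σᵥ (λ z → if inT s x y z then w s z else 0)

rem : ∀ {n} → State n → Fin n → ℕ
rem s v =
  (Σᵥ (λ u → if H s v u then WT s u v else 0)
    ∸ maxᵥ (λ u → if H s v u then WT s u v else 0))
  + w s v

-- Invariantly, the healing graph G′ is a forest on each tree of which the ID is constant.
-- A round deletes x and joins the vertices of S by a tree.  They lie in distinct trees of
-- G′ − x: distinct G′-neighbours of x lie in distinct subtrees of the forest; a vertex of
-- UN(x,G) has an ID different from that of x, hence from those of its G′-neighbours; and two
-- vertices of UN(x,G) in one tree share their ID, so by injectivity of the initial IDs they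
-- are the same class representative.  So G′ stays a forest, and the propagated ID is
-- constant on the merged tree.  In a forest the subtrees T(u,v), u ∈ N(v,G′), are disjoint
-- and avoid v, and all but T(q,v) lie in T(v,q), which also contains v.  Hence
-- Σᵤ W(T(u,v)) + w(v) ≤ W(T(q,v)) + W(T(v,q)), and W(T(q,v)) ≤ maxᵤ W(T(u,v)) gives
-- rem(v) ≤ W(T(v,q)), whatever the weights are.
module Submission where

open import Defs
open import Data.Nat using (ℕ; _≤_)
open import Data.Bool using (true)
open import Data.Fin using (Fin)
open import Relation.Binary.PropositionalEquality using (_≡_)

open import Level using (0ℓ)
open import Data.Nat
  using (zero; suc; _+_; _∸_; _⊔_; _/_; _<_; z≤n; s≤s; _≤′_; ≤′-refl; ≤′-step)
import Data.Nat.Properties as ℕ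
open import Data.Nat.DivMod using (m/n≤m)
import Data.Nat.ListAction as ListSum
import Algebra.Properties.CommutativeMonoid.Sum
open import Data.Bool using (Bool; false; _∧_; _∨_; not; if_then_else_)
import Data.Bool.Properties as Bool
open import Data.Bool.ListAction using (any)
open import Data.Fin using (_≟_; toℕ; fromℕ<)
import Data.Fin.Properties as Fin
open import Data.List using (List; []; _∷_; length; lookup; allFin; tabulate; foldr; map)
import Data.List.Properties as List
open import Data.List.Membership.Propositional using (_∈_; find; lose)
open import Data.List.Membership.Propositional.Properties using (∈-allFin; ∈-lookup)
open import Data.List.Membership.DecPropositional using (_∈?_)
open import Data.List.Relation.Unary.Any using (Any; here; there; any?)
import Data.List.Relation.Unary.All as All
open import Data.List.Relation.Unary.All.Properties using (¬Any⇒All¬)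
open import Data.List.Relation.Unary.AllPairs using ([]; _∷_)
open import Data.List.Relation.Unary.Unique.Propositional using (Unique)
import Data.Vec.Functional as Vector
open import Data.Product using (Σ; _×_; _,_; proj₁; proj₂)
open import Data.Sum using (_⊎_; inj₁; inj₂)
open import Data.Empty using (⊥-elim)
open import Function.Base using (id; _∘_)
open import Function.Bundles using (_⇔_; mk⇔; Equivalence)
open import Relation.Binary.Core using (Rel; _⇒_)
open import Relation.Binary.Definitions using (DecidableEquality)
import Relation.Binary.Definitions as Binary
open import Relation.Binary.Construct.Closure.ReflexiveTransitive
  using (Star; ε; _◅_; _◅◅_; return; reverse)
  renaming (map to mapStar)
open import Relation.Nullary using (¬_; Dec; yes; no)
open import Relation.Nullary.Decidable using (dec-true; dec-false; isYes≗does; map′; _×-dec_)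
open import Relation.Binary.PropositionalEquality
  using (_≢_; refl; sym; trans; cong; cong₂; subst; module ≡-Reasoning)

open Equivalence using (to; from)

private variable
  A : Set
  n : ℕ

∨-true : ∀ {b c} → b ∨ c ≡ true → b ≡ true ⊎ c ≡ true
∨-true {true}  _ = inj₁ refl
∨-true {false} c = inj₂ c

∧-true⇔ : ∀ {b c} → b ∧ c ≡ true ⇔ (b ≡ true × c ≡ true)
∧-true⇔ {true}  {true}  = mk⇔ (λ _ → refl , refl) (λ _ → refl)
∧-true⇔ {true}  {false} = mk⇔ (λ ()) proj₂
∧-true⇔ {false}         = mk⇔ (λ ()) proj₁

==-true⇔ : {x y : Fin n} → x == y ≡ true ⇔ x ≡ y
==-true⇔ {x = x} {y} = mk⇔ sound (λ x≡y → trans (isYes≗does (x ≟ y)) (dec-true (x ≟ y) x≡y))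
  where
  sound : x == y ≡ true → x ≡ y
  sound p with x ≟ y
  ... | yes x≡y = x≡y

==-false : {x y : Fin n} → x ≢ y → x == y ≡ false
==-false {x = x} {y} x≢y = trans (isYes≗does (x ≟ y)) (dec-false (x ≟ y) x≢y)

not-==-true⇔ : {x y : Fin n} → not (x == y) ≡ true ⇔ x ≢ y
not-==-true⇔ {x = x} {y} = mk⇔ sound (cong not ∘ ==-false)
  where
  sound : not (x == y) ≡ true → x ≢ y
  sound p with x ≟ y
  ... | no x≢y = x≢y

any-true : ∀ (f : A → Bool) xs → any f xs ≡ true → Σ A λ x → x ∈ xs × f x ≡ true
any-true f (x ∷ xs) p with ∨-true {f x} p
... | inj₁ fx = x , here refl , fx
... | inj₂ q with any-true f xs q
...   | y , y∈xs , fy = y , there y∈xs , fy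

true-any : ∀ (f : A → Bool) {xs x} → x ∈ xs → f x ≡ true → any f xs ≡ true
true-any f (here refl) fx rewrite fx = refl
true-any f {y ∷ _} (there x∈xs) fx with f y
... | true  = refl
... | false = true-any f x∈xs fx

-- Paths and reachability

Adj : Graph n → Rel (Fin n) 0ℓ
Adj g x y = g x y ≡ true

module _ {R : Rel A 0ℓ} where

  pathLength : ∀ {x y} → Star R x y → ℕ
  pathLength ε       = 0
  pathLength (_ ◅ p) = suc (pathLength p)

  vertices : ∀ {x y} → Star R x y → List A
  vertices {x = x} ε       = x ∷ []
  vertices {x = x} (_ ◅ p) = x ∷ vertices p

  length-vertices : ∀ {x y} (p : Star R x y) → length (vertices p) ≡ suc (pathLength p)
  length-vertices ε       = refl
  length-vertices (_ ◅ p) = cong suc (length-vertices p)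

  SimplePath : A → A → Set
  SimplePath x y = Σ (Star R x y) λ p → Unique (vertices p)

  simple-suffix : ∀ {x y z} (p : Star R x y) → Unique (vertices p) → z ∈ vertices p → SimplePath z y
  simple-suffix ε       u       (here refl) = ε , u
  simple-suffix (e ◅ p) u       (here refl) = e ◅ p , u
  simple-suffix (_ ◅ p) (_ ∷ u) (there z∈p) = simple-suffix p u z∈p

  -- Prepending a step that revisits the path cuts off the resulting loop.
  simplify : DecidableEquality A → ∀ {x y} → Star R x y → SimplePath x y
  simplify _≟ᴬ_ ε = ε , All.[] ∷ []
  simplify _≟ᴬ_ {x} (e ◅ p) with simplify _≟ᴬ_ p
  ... | p′ , u with _∈?_ _≟ᴬ_ x (vertices p′)
  ...   | yes x∈p′ = simple-suffix p′ u x∈p′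
  ...   | no  x∉p′ = e ◅ p′ , ¬Any⇒All¬ _ x∉p′ ∷ u

Unique⇒lookup-injective : (xs : List A) → Unique xs →
                          ∀ {i j} → lookup xs i ≡ lookup xs j → i ≡ j
Unique⇒lookup-injective (_ ∷ _)  (_  ∷ _) {Fin.zero}  {Fin.zero}  _ = refl
Unique⇒lookup-injective (_ ∷ _)  (x∉ ∷ _) {Fin.zero}  {Fin.suc j} e =
  ⊥-elim (All.lookup x∉ (∈-lookup j) e)
Unique⇒lookup-injective (_ ∷ _)  (x∉ ∷ _) {Fin.suc i} {Fin.zero}  e =
  ⊥-elim (All.lookup x∉ (∈-lookup i) (sym e))
Unique⇒lookup-injective (_ ∷ xs) (_  ∷ u) {Fin.suc i} {Fin.suc j} e =
  cong Fin.suc (Unique⇒lookup-injective xs u e)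

Unique⇒length≤ : (xs : List (Fin n)) → Unique xs → length xs ≤ n
Unique⇒length≤ xs u = Fin.injective⇒≤ (Unique⇒lookup-injective xs u)

module _ (g : Graph n) where

  reachWithin-sound : ∀ k {x y} → reachWithin g k x y ≡ true → Star (Adj g) x y
  reachWithin-sound zero    p = subst (Star _ _) (to ==-true⇔ p) ε
  reachWithin-sound (suc k) {x} {y} p with ∨-true {reachWithin g k x y} p
  ... | inj₁ q = reachWithin-sound k q
  ... | inj₂ q with any-true (λ c → reachWithin g k x c ∧ g c y) (allFin n) q
  ...   | _ , _ , r with to ∧-true⇔ r
  ...     | x⇝c , c→y = reachWithin-sound k x⇝c ◅◅ return c→y

  reachWithin-suc : ∀ k {x y} → reachWithin g k x y ≡ true → reachWithin g (suc k) x y ≡ true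
  reachWithin-suc k p rewrite p = refl

  reachWithin-extend : ∀ k {x y z} → reachWithin g k x y ≡ true → g y z ≡ true →
                       reachWithin g (suc k) x z ≡ true
  reachWithin-extend k {x} {y} {z} p e with reachWithin g k x z
  ... | true  = refl
  ... | false = true-any _ (∈-allFin y) (from ∧-true⇔ (p , e))

  reachWithin-mono : ∀ {k m} → k ≤ m → ∀ {x y} →
                     reachWithin g k x y ≡ true → reachWithin g m x y ≡ true
  reachWithin-mono k≤m = go (ℕ.≤⇒≤′ k≤m)
    where
    go : ∀ {k m} → k ≤′ m → ∀ {x y} → reachWithin g k x y ≡ true → reachWithin g m x y ≡ true
    go ≤′-refl         p = p
    go (≤′-step {m} l) p = reachWithin-suc m (go l p)

  reachWithin-◅◅ : ∀ k {x y z} → reachWithin g k x y ≡ true → (p : Star (Adj g) y z) →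
                   reachWithin g (k + pathLength p) x z ≡ true
  reachWithin-◅◅ k {x} r ε =
    subst (λ m → reachWithin g m x _ ≡ true) (sym (ℕ.+-identityʳ k)) r
  reachWithin-◅◅ k {x} {z = z} r (e ◅ p) =
    subst (λ m → reachWithin g m x z ≡ true) (sym (ℕ.+-suc k _))
          (reachWithin-◅◅ (suc k) (reachWithin-extend k r e) p)

  -- A path of any length can be shortened to a simple one, which has at most n vertices.
  reach⇔Star : ∀ {x y} → reach g x y ≡ true ⇔ Star (Adj g) x y
  reach⇔Star {x} {y} = mk⇔ (reachWithin-sound n) complete
    where
    complete : Star (Adj g) x y → reach g x y ≡ true
    complete p with simplify _≟_ p
    ... | p′ , u = reachWithin-mono short (reachWithin-◅◅ 0 (from ==-true⇔ refl) p′)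
      where
      short : pathLength p′ ≤ n
      short = ℕ.≤-trans (ℕ.n≤1+n _)
                (subst (_≤ n) (length-vertices p′) (Unique⇒length≤ (vertices p′) u))

-- Forests

module _ (R : Rel A 0ℓ) where

  WithoutVertex : A → Rel A 0ℓ
  WithoutVertex y a b = R a b × a ≢ y × b ≢ y

  WithoutEdge : A → A → Rel A 0ℓ
  WithoutEdge x y a b = R a b × ¬ ((a ≡ x × b ≡ y) ⊎ (a ≡ y × b ≡ x))

  WithEdge : A → A → Rel A 0ℓ
  WithEdge x y a b = R a b ⊎ (a ≡ x × b ≡ y) ⊎ (a ≡ y × b ≡ x)

  -- For a symmetric R this says that every edge is a bridge, i.e. R is a forest.
  Acyclic : Set
  Acyclic = ∀ {x y} → R x y → ¬ Star (WithoutEdge x y) x y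

deleteV⇔ : ∀ (g : Graph n) {y a b} → deleteV g y a b ≡ true ⇔ WithoutVertex (Adj g) y a b
deleteV⇔ g {y} {a} {b} = mk⇔ sound complete
  where
  sound : deleteV g y a b ≡ true → WithoutVertex (Adj g) y a b
  sound p with to ∧-true⇔ p
  ... | e , q with to (∧-true⇔ {not (a == y)}) q
  ...   | a≢y , b≢y = e , to not-==-true⇔ a≢y , to not-==-true⇔ b≢y
  complete : WithoutVertex (Adj g) y a b → deleteV g y a b ≡ true
  complete (e , a≢y , b≢y) =
    from ∧-true⇔ (e , from ∧-true⇔ (from not-==-true⇔ a≢y , from not-==-true⇔ b≢y))

inT⇔ : ∀ (s : State n) {u y z} →
       inT s u y z ≡ true ⇔ (u ≢ y × Star (WithoutVertex (Adj (H s)) y) u z)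
inT⇔ s = mk⇔
  (λ t → let u≢y , r = to ∧-true⇔ t in
    to not-==-true⇔ u≢y , mapStar (to (deleteV⇔ (H s))) (to (reach⇔Star _) r))
  (λ (u≢y , p) → from ∧-true⇔
    (from not-==-true⇔ u≢y , from (reach⇔Star _) (mapStar (from (deleteV⇔ (H s))) p)))

WithEdge-split : ∀ {R : Rel A 0ℓ} {c d y z} → Star (WithEdge R c d) y z →
                 Star R y z ⊎ (Star R y c × Star R d z) ⊎ (Star R y d × Star R c z)
WithEdge-split ε = inj₁ ε
WithEdge-split (inj₁ r ◅ p) with WithEdge-split p
... | inj₁ q                 = inj₁ (r ◅ q)
... | inj₂ (inj₁ (q₁ , q₂)) = inj₂ (inj₁ (r ◅ q₁ , q₂))
... | inj₂ (inj₂ (q₁ , q₂)) = inj₂ (inj₂ (r ◅ q₁ , q₂))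
WithEdge-split (inj₂ (inj₁ (refl , refl)) ◅ p) with WithEdge-split p
... | inj₁ q               = inj₂ (inj₁ (ε , q))
... | inj₂ (inj₁ (_ , q)) = inj₂ (inj₁ (ε , q))
... | inj₂ (inj₂ (_ , q)) = inj₁ q
WithEdge-split (inj₂ (inj₂ (refl , refl)) ◅ p) with WithEdge-split p
... | inj₁ q               = inj₂ (inj₂ (ε , q))
... | inj₂ (inj₁ (_ , q)) = inj₁ q
... | inj₂ (inj₂ (_ , q)) = inj₂ (inj₂ (ε , q))

module _ {R : Rel A 0ℓ} where

  symmetric-WithoutVertex : ∀ {y} → Binary.Symmetric R → Binary.Symmetric (WithoutVertex R y)
  symmetric-WithoutVertex sym-R (r , a≢y , b≢y) = sym-R r , b≢y , a≢y

  Acyclic⇒irreflexive : Acyclic R → ∀ {x} → ¬ R x x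
  Acyclic⇒irreflexive acyclic r = acyclic r ε

  Acyclic-⊆ : ∀ {R′ : Rel A 0ℓ} → R′ ⇒ R → Acyclic R → Acyclic R′
  Acyclic-⊆ R′⊆R acyclic r p = acyclic (R′⊆R r) (mapStar (λ (r′ , ne) → R′⊆R r′ , ne) p)

  WithoutVertex-into : ∀ {x y} → Star (WithoutVertex R y) x y → x ≡ y
  WithoutVertex-into ε                   = refl
  WithoutVertex-into ((_ , _ , c≢y) ◅ p) = ⊥-elim (c≢y (WithoutVertex-into p))

  avoid : DecidableEquality A → ∀ {x z} q → x ≢ q → Star R x z →
          Star (WithoutVertex R q) x z ⊎ Star R x q
  avoid _≟ᴬ_ q x≢q ε = inj₁ ε
  avoid _≟ᴬ_ q x≢q (_◅_ {j = c} e p) with c ≟ᴬ q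
  ... | yes refl = inj₂ (return e)
  ... | no  c≢q with avoid _≟ᴬ_ q c≢q p
  ...   | inj₁ p′ = inj₁ ((e , x≢q , c≢q) ◅ p′)
  ...   | inj₂ r  = inj₂ (e ◅ r)

  Acyclic-WithEdge : Binary.Symmetric R → Acyclic R → ∀ {c d} → ¬ Star R c d →
                     Acyclic (WithEdge R c d)
  Acyclic-WithEdge sym-R acyclic {c} {d} c≁d {a} {b} (inj₁ r) p
    with WithEdge-split (mapStar old-edges p)
    where
    old-edges : WithoutEdge (WithEdge R c d) a b ⇒ WithEdge (WithoutEdge R a b) c d
    old-edges (inj₁ r′ , ne) = inj₁ (r′ , ne)
    old-edges (inj₂ e  , _)  = inj₂ e
  ... | inj₁ q                 = acyclic r q
  ... | inj₂ (inj₁ (q₁ , q₂)) =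
    c≁d (reverse sym-R (mapStar proj₁ q₁) ◅◅ r ◅ reverse sym-R (mapStar proj₁ q₂))
  ... | inj₂ (inj₂ (q₁ , q₂)) = c≁d (mapStar proj₁ q₂ ◅◅ sym-R r ◅ mapStar proj₁ q₁)
  Acyclic-WithEdge sym-R acyclic {c} {d} c≁d (inj₂ (inj₁ (refl , refl))) p = c≁d (mapStar old-edge p)
    where
    old-edge : WithoutEdge (WithEdge R c d) c d ⇒ R
    old-edge (inj₁ r , _)  = r
    old-edge (inj₂ e , ne) = ⊥-elim (ne e)
  Acyclic-WithEdge sym-R acyclic {c} {d} c≁d (inj₂ (inj₂ (refl , refl))) p =
    c≁d (reverse sym-R (mapStar old-edge p))
    where
    old-edge : WithoutEdge (WithEdge R c d) d c ⇒ R
    old-edge (inj₁ r , _)                 = r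
    old-edge (inj₂ (inj₁ e) , ne)         = ⊥-elim (ne (inj₂ e))
    old-edge (inj₂ (inj₂ (e₁ , e₂)) , ne) = ⊥-elim (ne (inj₁ (e₁ , e₂)))

module _ {R : Rel A 0ℓ} (sym-R : Binary.Symmetric R) (acyclic : Acyclic R) where

  neighbours-separated : ∀ {v u u′} → R v u → R v u′ → u ≢ u′ →
                         ¬ Star (WithoutVertex R v) u u′
  neighbours-separated {v} {u} {u′} vu vu′ u≢u′ p =
    acyclic vu ((vu′ , other-edge) ◅ mapStar avoids-v (reverse (symmetric-WithoutVertex sym-R) p))
    where
    other-edge : ¬ ((v ≡ v × u′ ≡ u) ⊎ (v ≡ u × u′ ≡ v))
    other-edge (inj₁ (_ , u′≡u))    = u≢u′ (sym u′≡u)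
    other-edge (inj₂ (v≡u , u′≡v)) = u≢u′ (trans (sym v≡u) (sym u′≡v))
    avoids-v : WithoutVertex R v ⇒ WithoutEdge R v u
    avoids-v (r , a≢v , b≢v) =
      r , λ { (inj₁ (a≡v , _)) → a≢v a≡v ; (inj₂ (_ , b≡v)) → b≢v b≡v }

  module _ (_≟ᴬ_ : DecidableEquality A) {v : A} where

    branches-disjoint : ∀ {u u′ z} → R v u → R v u′ →
                        Star (WithoutVertex R v) u z → Star (WithoutVertex R v) u′ z → u ≡ u′
    branches-disjoint {u} {u′} vu vu′ p p′ with u ≟ᴬ u′
    ... | yes u≡u′ = u≡u′
    ... | no  u≢u′ = ⊥-elim (neighbours-separated vu vu′ u≢u′
                               (p ◅◅ reverse (symmetric-WithoutVertex sym-R) p′))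

    branch-beyond : ∀ {u q z} → R v u → R v q → u ≢ q →
                    Star (WithoutVertex R v) u z → Star (WithoutVertex R q) v z
    branch-beyond {u} {q} vu vq u≢q p with avoid _≟ᴬ_ q u≢q p
    ... | inj₁ p′ =
      (vu , v≢q , u≢q) ◅ mapStar (λ ((r , _) , a≢q , b≢q) → r , a≢q , b≢q) p′
      where
      v≢q : v ≢ q
      v≢q refl = Acyclic⇒irreflexive acyclic vq
    ... | inj₂ u⇝q = ⊥-elim (neighbours-separated vu vq u≢q u⇝q)

ParentEdge : ∀ {m} → (ℕ → ℕ) → (Fin m → A) → Rel A 0ℓ
ParentEdge {m = m} parent vtx a b = Σ (Fin m) λ i → Σ (Fin m) λ j →
  (1 ≤ toℕ i) × (toℕ j ≡ parent (toℕ i)) × (vtx i ≡ a) × (vtx j ≡ b)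

WithParentEdges : ∀ {m} → Rel A 0ℓ → (ℕ → ℕ) → (Fin m → A) → Rel A 0ℓ
WithParentEdges R parent vtx a b = R a b ⊎ ParentEdge parent vtx a b ⊎ ParentEdge parent vtx b a

-- Attaching the vertices vtx 1, vtx 2, … in turn to earlier ones adds each edge between two
-- components, as long as the vertices start out pairwise disconnected.
module _ {R : Rel A 0ℓ} (sym-R : Binary.Symmetric R) (acyclic-R : Acyclic R)
         {m} (vtx : Fin m → A) (separated : ∀ i j → i ≢ j → ¬ Star R (vtx i) (vtx j))
         (parent : ℕ → ℕ) (parent-< : ∀ k → parent (suc k) ≤ k) where

  ParentEdgeBelow : ℕ → Rel A 0ℓ
  ParentEdgeBelow k a b = Σ (Fin m) λ i → Σ (Fin m) λ j →
    (toℕ i < k) × (1 ≤ toℕ i) × (toℕ j ≡ parent (toℕ i)) × (vtx i ≡ a) × (vtx j ≡ b)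

  Attached : ℕ → Rel A 0ℓ
  Attached k a b = R a b ⊎ ParentEdgeBelow k a b ⊎ ParentEdgeBelow k b a

  SeparatedFrom : ℕ → Set
  SeparatedFrom k = ∀ l l′ → k ≤ toℕ l → l ≢ l′ → ¬ Star (Attached k) (vtx l) (vtx l′)

  symmetric-Attached : ∀ k → Binary.Symmetric (Attached k)
  symmetric-Attached k (inj₁ r)        = inj₁ (sym-R r)
  symmetric-Attached k (inj₂ (inj₁ e)) = inj₂ (inj₂ e)
  symmetric-Attached k (inj₂ (inj₂ e)) = inj₂ (inj₁ e)

  Attached-≤1 : ∀ {k} → k ≤ 1 → Attached k ⇒ R
  Attached-≤1 k≤1 (inj₁ r)                              = r
  Attached-≤1 k≤1 (inj₂ (inj₁ (_ , _ , i<k , 1≤i , _))) =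
    ⊥-elim (ℕ.<⇒≱ i<k (ℕ.≤-trans k≤1 1≤i))
  Attached-≤1 k≤1 (inj₂ (inj₂ (_ , _ , i<k , 1≤i , _))) =
    ⊥-elim (ℕ.<⇒≱ i<k (ℕ.≤-trans k≤1 1≤i))

  module NextEdge k (k<m : suc k < m) where

    child : Fin m
    child = fromℕ< k<m

    parent<m : parent (suc k) < m
    parent<m = ℕ.≤-<-trans (ℕ.m≤n⇒m≤1+n (parent-< k)) k<m

    father : Fin m
    father = fromℕ< parent<m

    toℕ-child : toℕ child ≡ suc k
    toℕ-child = Fin.toℕ-fromℕ< k<m

    father≤k : toℕ father ≤ k
    father≤k rewrite Fin.toℕ-fromℕ< parent<m = parent-< k

    ParentEdgeBelow-suc : ∀ {a b} → ParentEdgeBelow (suc (suc k)) a b →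
                          ParentEdgeBelow (suc k) a b ⊎ (a ≡ vtx child × b ≡ vtx father)
    ParentEdgeBelow-suc (i , j , i<k+2 , 1≤i , j≡ , refl , refl)
      with ℕ.m≤n⇒m<n∨m≡n (ℕ.≤-pred i<k+2)
    ... | inj₁ i<k+1 = inj₁ (i , j , i<k+1 , 1≤i , j≡ , refl , refl)
    ... | inj₂ i≡k+1 = inj₂ (cong vtx i≡child , cong vtx j≡father)
      where
      i≡child : i ≡ child
      i≡child = Fin.toℕ-injective (trans i≡k+1 (sym toℕ-child))
      j≡father : j ≡ father
      j≡father = Fin.toℕ-injective
        (trans j≡ (trans (cong parent i≡k+1) (sym (Fin.toℕ-fromℕ< parent<m))))

    Attached-suc : Attached (suc (suc k)) ⇒ WithEdge (Attached (suc k)) (vtx child) (vtx father)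
    Attached-suc (inj₁ r) = inj₁ (inj₁ r)
    Attached-suc (inj₂ (inj₁ e)) with ParentEdgeBelow-suc e
    ... | inj₁ e′        = inj₁ (inj₂ (inj₁ e′))
    ... | inj₂ (a≡ , b≡) = inj₂ (inj₁ (a≡ , b≡))
    Attached-suc (inj₂ (inj₂ e)) with ParentEdgeBelow-suc e
    ... | inj₁ e′        = inj₁ (inj₂ (inj₂ e′))
    ... | inj₂ (b≡ , a≡) = inj₂ (inj₂ (a≡ , b≡))

  distinct-indices : ∀ {k} {l l′ : Fin m} → k ≤ toℕ l → toℕ l′ < k → l ≢ l′
  distinct-indices k≤l l′<k refl = ℕ.<⇒≱ l′<k k≤l

  nothing-attached : ∀ {k} → k ≤ 1 → Acyclic (Attached k) × SeparatedFrom k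
  nothing-attached k≤1 =
    Acyclic-⊆ (Attached-≤1 k≤1) acyclic-R ,
    λ l l′ _ l≢l′ p → separated l l′ l≢l′ (mapStar (Attached-≤1 k≤1) p)

  attach-next : ∀ k (k<m : suc k < m) → Acyclic (Attached (suc k)) × SeparatedFrom (suc k) →
                Acyclic (Attached (suc (suc k))) × SeparatedFrom (suc (suc k))
  attach-next k k<m (acyclic , separated′) =
    Acyclic-⊆ Attached-suc (Acyclic-WithEdge (symmetric-Attached _) acyclic child≁father) ,
    still-separated
    where
    open NextEdge k k<m
    child≁father : ¬ Star (Attached (suc k)) (vtx child) (vtx father)
    child≁father = separated′ child father (ℕ.≤-reflexive (sym toℕ-child))
                     (distinct-indices (ℕ.≤-reflexive (sym toℕ-child)) (s≤s father≤k))
    still-separated : SeparatedFrom (suc (suc k))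
    still-separated l l′ l≥ l≢l′ p with WithEdge-split (mapStar Attached-suc p)
    ... | inj₁ q              = separated′ l l′ (ℕ.<⇒≤ l≥) l≢l′ q
    ... | inj₂ (inj₁ (q , _)) = separated′ l child (ℕ.<⇒≤ l≥)
                                  (distinct-indices l≥ (s≤s (ℕ.≤-reflexive toℕ-child))) q
    ... | inj₂ (inj₂ (q , _)) = separated′ l father (ℕ.<⇒≤ l≥)
                                  (distinct-indices l≥ (s≤s (ℕ.m≤n⇒m≤1+n father≤k))) q

  attach-all : ∀ k → k ≤ m → Acyclic (Attached k) × SeparatedFrom k
  attach-all zero          _   = nothing-attached z≤n
  attach-all (suc zero)    _   = nothing-attached ℕ.≤-refl
  attach-all (suc (suc k)) k<m = attach-next k k<m (attach-all (suc k) (ℕ.<⇒≤ k<m))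

  Acyclic-WithParentEdges : Acyclic (WithParentEdges R parent vtx)
  Acyclic-WithParentEdges = Acyclic-⊆ below-m (proj₁ (attach-all m ℕ.≤-refl))
    where
    below-m : WithParentEdges R parent vtx ⇒ Attached m
    below-m (inj₁ r)                  = inj₁ r
    below-m (inj₂ (inj₁ (i , j , e))) = inj₂ (inj₁ (i , j , Fin.toℕ<n i , e))
    below-m (inj₂ (inj₂ (i , j , e))) = inj₂ (inj₂ (i , j , Fin.toℕ<n i , e))

-- The DASH invariant

-- TreeEdge σ is, by definition, ParentEdge heap-parent (lookup σ).
heap-parent : ℕ → ℕ
heap-parent k = (k ∸ 1) / 2

heap-parent-< : ∀ k → heap-parent (suc k) ≤ k
heap-parent-< k = m/n≤m k 2

record Invariant (s : State n) : Set where
  field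
    H-symmetric : Binary.Symmetric (Adj (H s))
    H-acyclic   : Acyclic (Adj (H s))
    ID-constant : ∀ {a b} → Star (Adj (H s)) a b → ID s a ≡ ID s b
open Invariant

initial-Invariant : ∀ (G0 : Graph n) ID0 → Invariant (initState G0 ID0)
initial-Invariant G0 ID0 = record { H-symmetric = λ () ; H-acyclic = λ () ; ID-constant = constant }
  where
  constant : ∀ {a b} → Star (Adj (H (initState G0 ID0))) a b → ID0 a ≡ ID0 b
  constant ε = refl

module _ {G0 : Graph n} {ID0 : Fin n → ℕ} (ID0-injective : InjectiveIDs ID0)
         {s s′ : State n} (I : Invariant s) (round : Step G0 ID0 s s′) where
  open Step round

  private
    K : Rel (Fin n) 0ℓ
    K = WithoutVertex (Adj (H s)) x

    H′ : Rel (Fin n) 0ℓ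
    H′ = Adj (H s′)

  in-S : ∀ i → InS ID0 s x (lookup σ i)
  in-S i = to (σ-mem _) (∈-lookup i)

  UN-unique : ∀ {a b} → InUN ID0 s x a → InUN ID0 s x b → ID s a ≡ ID s b → a ≡ b
  UN-unique {a} {b} (xa , _ , a-least) (xb , _ , b-least) e =
    ID0-injective a b (ℕ.≤-antisym (a-least b xb (sym e)) (b-least a xa e))

  UN-off-tree : ∀ {a b} → InUN ID0 s x a → H s x b ≡ true → ¬ Star K a b
  UN-off-tree (_ , a≠x , _) xb p =
    a≠x (trans (ID-constant I (mapStar proj₁ p)) (sym (ID-constant I (return xb))))

  S-separated : ∀ i j → i ≢ j → ¬ Star K (lookup σ i) (lookup σ j)
  S-separated i j i≢j p with in-S i | in-S j
  ... | inj₁ ua | inj₁ ub =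
    i≢j (Unique⇒lookup-injective σ σ-unique (UN-unique ua ub (ID-constant I (mapStar proj₁ p))))
  ... | inj₁ ua | inj₂ hb = UN-off-tree ua hb p
  ... | inj₂ ha | inj₁ ub = UN-off-tree ub ha (reverse (symmetric-WithoutVertex (H-symmetric I)) p)
  ... | inj₂ ha | inj₂ hb = neighbours-separated (H-symmetric I) (H-acyclic I) ha hb
                              (i≢j ∘ Unique⇒lookup-injective σ σ-unique) p

  H′⇒tree : H′ ⇒ WithParentEdges K heap-parent (lookup σ)
  H′⇒tree {a} {b} e with to (H' a b) e
  ... | inj₁ d = inj₁ (to (deleteV⇔ (H s)) d)
  ... | inj₂ t = inj₂ t

  tree⇒H′ : WithParentEdges K heap-parent (lookup σ) ⇒ H′
  tree⇒H′ {a} {b} (inj₁ k) = from (H' a b) (inj₁ (from (deleteV⇔ (H s)) k))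
  tree⇒H′ {a} {b} (inj₂ t) = from (H' a b) (inj₂ t)

  H′-symmetric : Binary.Symmetric H′
  H′-symmetric e with H′⇒tree e
  ... | inj₁ k        = tree⇒H′ (inj₁ (symmetric-WithoutVertex (H-symmetric I) k))
  ... | inj₂ (inj₁ t) = tree⇒H′ (inj₂ (inj₂ t))
  ... | inj₂ (inj₂ t) = tree⇒H′ (inj₂ (inj₁ t))

  H′-acyclic : Acyclic H′
  H′-acyclic = Acyclic-⊆ H′⇒tree
    (Acyclic-WithParentEdges (symmetric-WithoutVertex (H-symmetric I)) (Acyclic-⊆ proj₁ (H-acyclic I))
       (lookup σ) S-separated heap-parent heap-parent-<)

  Touched : Fin n → Set
  Touched a = Σ (Fin n) λ t → InS ID0 s x t × (reach (H s′) t a ≡ true)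

  touched? : ∀ a → Dec (Touched a)
  touched? a = map′ from-any to-any (any? (λ t → reach (H s′) t a Bool.≟ true) σ)
    where
    from-any : Any (λ t → reach (H s′) t a ≡ true) σ → Touched a
    from-any hit with find hit
    ... | t , t∈σ , r = t , to (σ-mem t) t∈σ , r
    to-any : Touched a → Any (λ t → reach (H s′) t a ≡ true) σ
    to-any (t , t∈S , r) = lose (from (σ-mem t) t∈S) r

  touched-◅◅ : ∀ {a b} → Touched a → Star H′ a b → Touched b
  touched-◅◅ (t , t∈S , r) p =
    t , t∈S , from (reach⇔Star (H s′)) (to (reach⇔Star (H s′)) r ◅◅ p)

  in-S-touched : ∀ i → Touched (lookup σ i)
  in-S-touched i = lookup σ i , in-S i , from (reach⇔Star (H s′)) ε

  -- Every new edge has an endpoint in S, so a path from an untouched vertex uses only old edges.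
  untouched-path : ∀ {a b} → ¬ Touched a → Star H′ a b → Star K a b
  untouched-path ¬ta ε = ε
  untouched-path ¬ta (e ◅ p) with H′⇒tree e
  ... | inj₁ k = k ◅ untouched-path (λ tc → ¬ta (touched-◅◅ tc (return (H′-symmetric e)))) p
  ... | inj₂ (inj₁ (i , _ , _ , _ , refl , _)) = ⊥-elim (¬ta (in-S-touched i))
  ... | inj₂ (inj₂ (_ , j , _ , _ , _ , refl)) = ⊥-elim (¬ta (in-S-touched j))

  ID′-constant : ∀ {a b} → Star H′ a b → ID s′ a ≡ ID s′ b
  ID′-constant {a} {b} p with touched? a
  ... | yes ta  = trans (ID-in a ta) (sym (ID-in b (touched-◅◅ ta p)))
  ... | no  ¬ta = trans (ID-out a ¬ta) (trans (ID-constant I (mapStar proj₁ (untouched-path ¬ta p)))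
                    (sym (ID-out b (λ tb → ¬ta (touched-◅◅ tb (reverse H′-symmetric p))))))

  step-Invariant : Invariant s′
  step-Invariant = record
    { H-symmetric = H′-symmetric ; H-acyclic = H′-acyclic ; ID-constant = ID′-constant }

reachable-Invariant : ∀ {G0 : Graph n} {ID0} → InjectiveIDs ID0 →
                      ∀ {s} → Reachable G0 ID0 s → Invariant s
reachable-Invariant {G0 = G0} {ID0} _   init        = initial-Invariant G0 ID0
reachable-Invariant                 inj (step r st) = step-Invariant inj (reachable-Invariant inj r) st

-- Finite sums

module Sum = Algebra.Properties.CommutativeMonoid.Sum ℕ.+-0-commutativeMonoid
open Sum using (sum)

Σᵥ≡sum : (f : Fin n → ℕ) → Σᵥ f ≡ sum f
Σᵥ≡sum f = trans (cong ListSum.sum (List.map-tabulate id f)) (tabulate-sum f)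
  where
  tabulate-sum : ∀ {n} (f : Fin n → ℕ) → ListSum.sum (tabulate f) ≡ sum f
  tabulate-sum {zero}  f = refl
  tabulate-sum {suc n} f = cong (f Fin.zero +_) (tabulate-sum (f ∘ Fin.suc))

sum-mono-≤ : {f g : Fin n → ℕ} → (∀ i → f i ≤ g i) → sum f ≤ sum g
sum-mono-≤ {zero}  f≤g = z≤n
sum-mono-≤ {suc n} f≤g = ℕ.+-mono-≤ (f≤g Fin.zero) (sum-mono-≤ (f≤g ∘ Fin.suc))

≤-sum : (f : Fin n → ℕ) → ∀ i → f i ≤ sum f
≤-sum f Fin.zero    = ℕ.m≤m+n _ _
≤-sum f (Fin.suc i) = ℕ.≤-trans (≤-sum (f ∘ Fin.suc) i) (ℕ.m≤n+m _ _)

sum-supported-at : (f : Fin n → ℕ) (j : Fin n) → (∀ i → i ≢ j → f i ≡ 0) → sum f ≡ f j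
sum-supported-at {suc n} f j off-j = begin
  sum f                             ≡⟨ Sum.sum-remove f ⟩
  f j + sum (Vector.removeAt f j)   ≡⟨ cong (f j +_) (Sum.sum-cong-≗ (off-j _ ∘ Fin.punchInᵢ≢i j)) ⟩
  f j + sum (Vector.replicate n 0)  ≡⟨ cong (f j +_) (Sum.sum-replicate-zero n) ⟩
  f j + 0                           ≡⟨ ℕ.+-identityʳ (f j) ⟩
  f j                               ∎
  where open ≡-Reasoning

≤-maxᵥ : (f : Fin n → ℕ) → ∀ i → f i ≤ maxᵥ f
≤-maxᵥ f i = ≤-foldr-⊔ (∈-allFin i)
  where
  ≤-foldr-⊔ : ∀ {i xs} → i ∈ xs → f i ≤ foldr _⊔_ 0 (map f xs)
  ≤-foldr-⊔ (here refl)               = ℕ.m≤m⊔n _ _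
  ≤-foldr-⊔ {xs = y ∷ _} (there i∈xs) = ℕ.≤-trans (≤-foldr-⊔ i∈xs) (ℕ.m≤n⊔m (f y) _)

-- Branches at a vertex

module AroundVertex {s : State n} (I : Invariant s) (v q : Fin n) (vq : H s v q ≡ true) where

  private
    sym-H : Binary.Symmetric (Adj (H s))
    sym-H = H-symmetric I

    acyclic-H : Acyclic (Adj (H s))
    acyclic-H = H-acyclic I

  v≢q : v ≢ q
  v≢q refl = Acyclic⇒irreflexive acyclic-H vq

  weightIn : Fin n → Fin n → Fin n → ℕ
  weightIn u y z = if inT s u y z then w s z else 0

  branchWeight : Fin n → Fin n → ℕ
  branchWeight u z = if H s v u then weightIn u v z else 0

  neighbourWeight : Fin n → ℕ
  neighbourWeight u = if H s v u then WT s u v else 0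

  weightAtV : Fin n → ℕ
  weightAtV z = if z == v then w s z else 0

  neighbourWeight≡sum : ∀ u → neighbourWeight u ≡ sum (branchWeight u)
  neighbourWeight≡sum u with H s v u
  ... | true  = Σᵥ≡sum (weightIn u v)
  ... | false = sym (Sum.sum-replicate-zero n)

  weightIn-beyond : ∀ {z} → Star (WithoutVertex (Adj (H s)) q) v z → weightIn v q z ≡ w s z
  weightIn-beyond p rewrite from (inT⇔ s) (v≢q , p) = refl

  branchWeight-in : ∀ {u z} → H s v u ≡ true → inT s u v z ≡ true → branchWeight u z ≡ w s z
  branchWeight-in vu z∈u rewrite vu | z∈u = refl

  branchWeight-out : ∀ {u z} → ¬ (H s v u ≡ true × inT s u v z ≡ true) → branchWeight u z ≡ 0
  branchWeight-out {u} {z} z∉u with H s v u | inT s u v z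
  ... | true  | true  = ⊥-elim (z∉u (refl , refl))
  ... | true  | false = refl
  ... | false | _     = refl

  weightAtV-at : weightAtV v ≡ w s v
  weightAtV-at rewrite from (==-true⇔ {x = v}) refl = refl

  weightAtV-off : ∀ {z} → z ≢ v → weightAtV z ≡ 0
  weightAtV-off z≢v rewrite ==-false z≢v = refl

  -- A vertex z ≠ v lies in at most one branch T(u,v), and every branch but T(q,v) lies in T(v,q).
  pointwise-in-branch : ∀ {z u₀} → H s v u₀ ≡ true → inT s u₀ v z ≡ true →
    sum (λ u → branchWeight u z) + weightAtV z ≤ branchWeight q z + weightIn v q z
  pointwise-in-branch {z} {u₀} vu₀ z∈u₀ = begin
    sum (λ u → branchWeight u z) + weightAtV z  ≡⟨ cong₂ _+_ only-u₀ (weightAtV-off z≢v) ⟩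
    branchWeight u₀ z + 0                       ≡⟨ ℕ.+-identityʳ _ ⟩
    branchWeight u₀ z                           ≡⟨ branchWeight-in vu₀ z∈u₀ ⟩
    w s z                                       ≤⟨ w≤ (u₀ ≟ q) ⟩
    branchWeight q z + weightIn v q z           ∎
    where
    open ℕ.≤-Reasoning
    u₀⇝z = proj₂ (to (inT⇔ s) z∈u₀)
    z≢v : z ≢ v
    z≢v refl = proj₁ (to (inT⇔ s) z∈u₀) (WithoutVertex-into u₀⇝z)
    only-u₀ : sum (λ u → branchWeight u z) ≡ branchWeight u₀ z
    only-u₀ = sum-supported-at _ u₀ λ u u≢u₀ → branchWeight-out λ (vu , z∈u) →
      u≢u₀ (branches-disjoint sym-H acyclic-H _≟_ vu vu₀ (proj₂ (to (inT⇔ s) z∈u)) u₀⇝z)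
    w≤ : Dec (u₀ ≡ q) → w s z ≤ branchWeight q z + weightIn v q z
    w≤ (yes refl) = ℕ.≤-trans (ℕ.≤-reflexive (sym (branchWeight-in vu₀ z∈u₀))) (ℕ.m≤m+n _ _)
    w≤ (no u₀≢q)  = ℕ.≤-trans (ℕ.≤-reflexive (sym (weightIn-beyond z∈T[v,q]))) (ℕ.m≤n+m _ _)
      where z∈T[v,q] = branch-beyond sym-H acyclic-H _≟_ vu₀ vq u₀≢q u₀⇝z

  pointwise-outside : ∀ {z} → (∀ u → ¬ (H s v u ≡ true × inT s u v z ≡ true)) →
    sum (λ u → branchWeight u z) + weightAtV z ≤ branchWeight q z + weightIn v q z
  pointwise-outside {z} outside = begin
    sum (λ u → branchWeight u z) + weightAtV z  ≡⟨ cong (_+ weightAtV z) nobody ⟩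
    weightAtV z                                 ≤⟨ at-v (z ≟ v) ⟩
    weightIn v q z                              ≤⟨ ℕ.m≤n+m _ _ ⟩
    branchWeight q z + weightIn v q z           ∎
    where
    open ℕ.≤-Reasoning
    nobody : sum (λ u → branchWeight u z) ≡ 0
    nobody = trans (Sum.sum-cong-≗ (branchWeight-out ∘ outside)) (Sum.sum-replicate-zero n)
    at-v : Dec (z ≡ v) → weightAtV z ≤ weightIn v q z
    at-v (yes refl) = ℕ.≤-reflexive (trans weightAtV-at (sym (weightIn-beyond ε)))
    at-v (no z≢v)   = subst (_≤ weightIn v q z) (sym (weightAtV-off z≢v)) z≤n

  pointwise : ∀ z → sum (λ u → branchWeight u z) + weightAtV z ≤ branchWeight q z + weightIn v q z
  pointwise z with Fin.any? (λ u → (H s v u Bool.≟ true) ×-dec (inT s u v z Bool.≟ true))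
  ... | yes (_ , vu₀ , z∈u₀) = pointwise-in-branch vu₀ z∈u₀
  ... | no  none             = pointwise-outside (λ u in-u → none (u , in-u))

  branches-fit : Σᵥ neighbourWeight + w s v ≤ neighbourWeight q + WT s v q
  branches-fit = begin
    Σᵥ neighbourWeight + w s v
      ≡⟨ cong₂ _+_ (trans (Σᵥ≡sum neighbourWeight) (Sum.sum-cong-≗ neighbourWeight≡sum))
                   (sym total-at-v) ⟩
    sum (λ u → sum (branchWeight u)) + sum weightAtV
      ≡⟨ cong (_+ sum weightAtV) (Sum.∑-comm branchWeight) ⟩
    sum (λ z → sum (λ u → branchWeight u z)) + sum weightAtV
      ≡⟨ Sum.∑-distrib-+ (λ z → sum (λ u → branchWeight u z)) weightAtV ⟨
    sum (λ z → sum (λ u → branchWeight u z) + weightAtV z)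
      ≤⟨ sum-mono-≤ pointwise ⟩
    sum (λ z → branchWeight q z + weightIn v q z)
      ≡⟨ Sum.∑-distrib-+ (branchWeight q) (weightIn v q) ⟩
    sum (branchWeight q) + sum (weightIn v q)
      ≡⟨ cong₂ _+_ (sym (neighbourWeight≡sum q)) (sym (Σᵥ≡sum (weightIn v q))) ⟩
    neighbourWeight q + WT s v q ∎
    where
    open ℕ.≤-Reasoning
    total-at-v : sum weightAtV ≡ w s v
    total-at-v = trans (sum-supported-at weightAtV v (λ _ → weightAtV-off)) weightAtV-at

  rem≤WT : rem s v ≤ WT s v q
  rem≤WT = begin
    (Σᵥ f ∸ maxᵥ f) + w s v    ≤⟨ ℕ.+-monoˡ-≤ (w s v) (ℕ.∸-monoʳ-≤ (Σᵥ f) (≤-maxᵥ f q)) ⟩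
    (Σᵥ f ∸ f q) + w s v       ≡⟨ ℕ.+-∸-comm (w s v) fq≤Σ ⟨
    (Σᵥ f + w s v) ∸ f q       ≤⟨ ℕ.∸-monoˡ-≤ (f q) branches-fit ⟩
    (f q + WT s v q) ∸ f q     ≡⟨ ℕ.m+n∸m≡n (f q) (WT s v q) ⟩
    WT s v q                   ∎
    where
    open ℕ.≤-Reasoning
    f = neighbourWeight
    fq≤Σ : f q ≤ Σᵥ f
    fq≤Σ = subst (f q ≤_) (sym (Σᵥ≡sum f)) (≤-sum f q)

lemma3 : ∀ {n} (G0 : Graph n) (ID0 : Fin n → ℕ) →
    Symmetric G0 → Irreflexive G0 → Connected G0 → InjectiveIDs ID0 →
    ∀ (s : State n) → Reachable G0 ID0 s →
    ∀ (v q : Fin n) → alive s v ≡ true → H s v q ≡ true →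
    rem s v ≤ WT s v q
lemma3 G0 ID0 _ _ _ ID0-injective s reachable v q _ vq =
  AroundVertex.rem≤WT (reachable-Invariant ID0-injective reachable) v q vq
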